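{- The color map $c$ is a bijection from $\mathcal{R}_n$ onto $\overline{\mathcal{G}}_n$. In particular $|\overline{\mathcal{G}}_n|=n^{n-1}$.
   Context: Let $X=\{x_1<\dots<x_n\}$. A two-colored graph on $X$ is a connected graph on vertex set $X$ whose edges are each colored red or blue. $\overline{\mathcal{G}}_n$ is the set of two-colored graphs on $X$ that are trees and avoid the following three patterns: (1) there are $i<j<k$ with $\{i,k\}$ and $\{j,k\}$ both red edges; (2) there are $i<j<k$ with $\{i,j\}$ and $\{i,k\}$ both blue edges; (3) there are $i<j<k$ with $\{i,j\}$ a red edge and $\{j,k\}$ a blue edge. $\mathcal{R}_n$ is the set of rooted trees on vertex set $X$ (uncolored). For an edge of a rooted tree between a parent $p$ and its child $q$, the edge is increasing if $p<q$ and decreasing if $p>q$. The color map $c$ sends $T\in\mathcal{R}_n$ to the two-colored tree obtained by forgetting the root and coloring increasing edges red and decreasing edges blue. -}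

module Defs where

open import Data.Nat using (ℕ; suc; _≤_; _^_; _∸_)
open import Data.Fin using (Fin; _<_; _<?_)
open import Data.Fin.Properties using (_≟_)
open import Data.Maybe using (Maybe; just; nothing)
open import Data.Maybe.Properties using (≡-dec)
open import Data.List using (List; []; _∷_; length; head; last)
open import Data.List.Relation.Unary.Unique.Propositional using (Unique)
open import Data.List.Relation.Unary.Linked using (Linked)
open import Data.Product using (Σ; Σ-syntax; ∃; _×_)
open import Relation.Binary.PropositionalEquality using (_≡_)
open import Relation.Nullary using (¬_; yes; no)

-- Vertex set X = {x_1 < ... < x_n} is modelled by Fin n with its usual order.

data Color : Set where
  red blue : Color

-- A two-colored (simple) graph on Fin n: g i j = just c  iff  {i,j} is an
-- edge of color c, nothing iff there is no edge.
Coloring : ℕ → Set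
Coloring n = Fin n → Fin n → Maybe Color

Adj : ∀ {n} → Coloring n → Fin n → Fin n → Set
Adj g i j = ∃ λ c → g i j ≡ just c

Red : ∀ {n} → Coloring n → Fin n → Fin n → Set
Red g i j = g i j ≡ just red

Blue : ∀ {n} → Coloring n → Fin n → Fin n → Set
Blue g i j = g i j ≡ just blue

data Walk {n} (g : Coloring n) : Fin n → Fin n → Set where
  stop : ∀ {i} → Walk g i i
  step : ∀ {i j k} → Adj g i j → Walk g j k → Walk g i k

record IsCycle {n} (g : Coloring n) (vs : List (Fin n)) : Set where
  field
    long     : 3 ≤ length vs
    distinct : Unique vs
    path     : Linked (Adj g) vs
    closing  : ∀ a b → head vs ≡ just a → last vs ≡ just b → Adj g b a

record IsTwoColoredTree {n} (g : Coloring n) : Set where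
  field
    symmetric   : ∀ i j → g i j ≡ g j i
    irreflexive : ∀ i → g i i ≡ nothing
    connected   : ∀ i j → Walk g i j
    acyclic     : ∀ vs → ¬ IsCycle g vs

Pattern1 Pattern2 Pattern3 : ∀ {n} → Coloring n → Set
Pattern1 {n} g = Σ[ i ∈ Fin n ] Σ[ j ∈ Fin n ] Σ[ k ∈ Fin n ]
  (i < j × j < k × Red g i k × Red g j k)
Pattern2 {n} g = Σ[ i ∈ Fin n ] Σ[ j ∈ Fin n ] Σ[ k ∈ Fin n ]
  (i < j × j < k × Blue g i j × Blue g i k)
Pattern3 {n} g = Σ[ i ∈ Fin n ] Σ[ j ∈ Fin n ] Σ[ k ∈ Fin n ]
  (i < j × j < k × Red g i j × Blue g j k)

InGbar : ∀ {n} → Coloring n → Set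
InGbar g = IsTwoColoredTree g × ¬ Pattern1 g × ¬ Pattern2 g × ¬ Pattern3 g

-- Rooted trees on Fin n, represented by their parent map
-- (parent v = nothing iff v is the root).

Parent : ℕ → Set
Parent n = Fin n → Maybe (Fin n)

data Reaches {n} (par : Parent n) : Fin n → Fin n → Set where
  here : ∀ {r} → Reaches par r r
  up   : ∀ {v u r} → par v ≡ just u → Reaches par u r → Reaches par v r

IsRootedTree : ∀ {n} → Parent n → Set
IsRootedTree {n} par = Σ[ r ∈ Fin n ]
  (par r ≡ nothing × (∀ v → par v ≡ nothing → v ≡ r) × (∀ v → Reaches par v r))

-- the color map c: forget the root, color increasing edges (parent < child)
-- red and decreasing edges (parent > child) blue
orient : ∀ {n} → Fin n → Fin n → Color
orient p q with p <? q
... | yes _ = red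
... | no  _ = blue

colorMap : ∀ {n} → Parent n → Coloring n
colorMap par i j with ≡-dec _≟_ (par j) (just i)
... | yes _ = just (orient i j)
... | no  _ with ≡-dec _≟_ (par i) (just j)
...   | yes _ = just (orient j i)
...   | no  _ = nothing

-- Each forbidden pattern would give a vertex two parents, so
-- c lands in Ḡₙ, and since the color and the order of the endpoints tell which
-- one is the parent, c is injective.  Conversely, in a pattern-free tree every
-- vertex has at most one neighbour that can serve as its parent; following
-- these parents never closes a cycle, so it ends at a common root, and the
-- parent map obtained is a preimage.  Rooted trees are counted by Prüfer codes:
-- removing the least childless vertex and recording its parent, n − 1 times,
-- gives a bijection with the maps Fin (n − 1) → Fin n.
module Submission where

open import Defs
open import Level using (0ℓ)
open import Data.Nat as ℕ using (ℕ; zero; suc; _+_; _≤_; _^_; _∸_; z≤n; s≤s)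
import Data.Nat.Properties as ℕ
open import Data.Fin using (Fin; zero; suc; _<_; _<?_; punchIn; punchOut; combine; funToFin; finToFun)
open import Data.Fin.Properties
  using (_≟_; <-cmp; <-asym; <-irrefl; <-trans; any?; ¬∀⟶∃¬; injective⇒≤; punchIn-injective; punchInᵢ≢i;
         punchIn-punchOut; punchOut-punchIn; punchOut-cong; punchOut-injective; funToFin-finToFin; finToFun-funToFin)
open import Data.Maybe using (Maybe; just; nothing; maybe; _>>=_)
import Data.Maybe as Maybe
open import Data.Maybe.Properties using (≡-dec; just-injective; map-injective)
open import Data.Maybe.Relation.Binary.Connected using (Connected; just; just-nothing)
open import Data.List using (List; []; _∷_; head; last; length; lookup; allFin)
open import Data.List.Relation.Unary.All as All using (All; []; _∷_)
open import Data.List.Relation.Unary.All.Properties using (All¬⇒¬Any; ¬Any⇒All¬)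
open import Data.List.Relation.Unary.Any using (here; there)
open import Data.List.Relation.Unary.AllPairs as AllPairs using ([]; _∷_)
open import Data.List.Relation.Unary.Unique.Propositional using (Unique)
open import Data.List.Relation.Unary.Linked as Linked using (Linked; []; [-]; _∷_)
open import Data.List.Membership.Propositional using (_∈_; _∉_)
open import Data.List.Membership.Propositional.Properties using (∈-lookup; ∈-allFin)
import Data.List.Membership.DecPropositional as DecMembership
open import Data.List.Extrema.Nat using (argmax; f[xs]≤f[argmax])
open import Data.Vec.Functional using () renaming (_∷_ to _◂_)
open import Data.Product using (Σ-syntax; ∃; ∃₂; _×_; _,_; proj₁; proj₂; map₂)
open import Data.Sum using (_⊎_; inj₁; inj₂)
open import Data.Sum.Function.Propositional using (_⊎-⇔_)
open import Data.Empty using (⊥; ⊥-elim)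
open import Function using (_∘_; _⇔_; mk⇔; Equivalence)
open import Function.Construct.Identity using (⇔-id)
open import Function.Properties.Equivalence using (⇔-setoid)
open import Relation.Binary using (tri<; tri≈; tri>)
import Relation.Binary.Reasoning.Setoid as SetoidReasoning
open import Relation.Binary.PropositionalEquality
open import Relation.Nullary using (¬_; Dec; yes; no; contradiction; ¬?)
open import Relation.Unary using (Pred; Decidable)

last-∷ : ∀ {A : Set} (x : A) xs → ∃ λ y → last (x ∷ xs) ≡ just y
last-∷ x []       = x , refl
last-∷ x (y ∷ xs) = last-∷ y xs

last-∈ : ∀ {A : Set} {x y : A} xs → last (x ∷ xs) ≡ just y → y ∈ x ∷ xs
last-∈ []       refl = here refl
last-∈ (_ ∷ xs) eq   = there (last-∈ xs eq)

all⇒connected : ∀ {A : Set} {x : A} {xs} → All (x ≢_) xs → Connected _≢_ (just x) (head xs)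
all⇒connected []      = just-nothing
all⇒connected (p ∷ _) = just p

unique⇒lookup-injective : ∀ {A : Set} {xs : List A} → Unique xs →
                          ∀ {i j} → lookup xs i ≡ lookup xs j → i ≡ j
unique⇒lookup-injective (_ ∷ _)  {zero}  {zero}  _  = refl
unique⇒lookup-injective (x∉ ∷ _) {zero}  {suc j} eq = contradiction eq (All.lookup x∉ (∈-lookup j))
unique⇒lookup-injective (x∉ ∷ _) {suc i} {zero}  eq = contradiction (sym eq) (All.lookup x∉ (∈-lookup i))
unique⇒lookup-injective (_ ∷ u)  {suc i} {suc j} eq = cong suc (unique⇒lookup-injective u eq)

unique⇒length≤ : ∀ {n} {xs : List (Fin n)} → Unique xs → length xs ≤ n
unique⇒length≤ u = injective⇒≤ (unique⇒lookup-injective u)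

prefixUpTo : ∀ {A : Set} {R : A → A → Set} {x c cs} →
             x ∈ c ∷ cs → Unique (c ∷ cs) → Linked R (c ∷ cs) →
           ∃ λ ys → Unique (c ∷ ys) × Linked R (c ∷ ys) × last (c ∷ ys) ≡ just x
                    × (∀ {P : A → Set} → All P (c ∷ cs) → All P (c ∷ ys))
prefixUpTo (here refl) _ _ = [] , [] ∷ [] , [-] , refl , λ { (p ∷ _) → p ∷ [] }
prefixUpTo (there x∈) (c∉ ∷ u) (r ∷ l) with ys , u′ , l′ , lst , keep ← prefixUpTo x∈ u l =
  _ ∷ ys , keep c∉ ∷ u′ , r ∷ l′ , lst , λ { (p ∷ ps) → p ∷ keep ps }

map-just : ∀ {A B : Set} {f : A → B} {m y} → Maybe.map f m ≡ just y → ∃ λ x → m ≡ just x × f x ≡ y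
map-just {m = just x} eq = x , refl , just-injective eq

Least : ∀ {n} → Pred (Fin n) 0ℓ → Fin n → Set
Least P v = P v × (∀ {u} → u < v → ¬ P u)

least : ∀ {n} {P : Pred (Fin n) 0ℓ} → Decidable P → ∃ P → ∃ (Least P)
least {zero}  _  (() , _)
least {suc n} P? (v , pv) with P? zero
least P? (v     , pv) | yes p₀ = zero , p₀ , λ ()
least P? (zero  , p₀) | no ¬p₀ = contradiction p₀ ¬p₀
least P? (suc v , pv) | no ¬p₀ with w , pw , below ← least (P? ∘ suc) (v , pv) =
  suc w , pw , λ { {zero} _ → ¬p₀ ; {suc u} (s≤s u<w) → below u<w }

Least-unique : ∀ {n} {P Q : Pred (Fin n) 0ℓ} {v w} → (∀ {u} → P u → Q u) → (∀ {u} → Q u → P u) →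
               Least P v → Least Q w → v ≡ w
Least-unique {v = v} {w} P⇒Q Q⇒P (pv , v-least) (qw , w-least) with <-cmp v w
... | tri< v<w _ _ = contradiction (P⇒Q pv) (w-least v<w)
... | tri≈ _ v≡w _ = v≡w
... | tri> _ _ w<v = contradiction (Q⇒P qw) (v-least w<v)

orient-< : ∀ {n} {i j : Fin n} → i < j → orient i j ≡ red
orient-< {i = i} {j} i<j with i <? j
... | yes _   = refl
... | no i≮j = contradiction i<j i≮j

orient-≮ : ∀ {n} {i j : Fin n} → ¬ i < j → orient i j ≡ blue
orient-≮ {i = i} {j} i≮j with i <? j
... | yes i<j = contradiction i<j i≮j
... | no _    = refl

orient-red⇒< : ∀ {n} {i j : Fin n} → orient i j ≡ red → i < j
orient-red⇒< {i = i} {j} eq with i <? j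
... | yes i<j = i<j
... | no _    = contradiction eq λ ()

orient-blue⇒≮ : ∀ {n} {i j : Fin n} → orient i j ≡ blue → ¬ i < j
orient-blue⇒≮ {i = i} {j} eq with i <? j
... | yes _   = contradiction eq λ ()
... | no i≮j = i≮j

orient-injective : ∀ {n} {i j : Fin n} → orient i j ≡ orient j i → i ≡ j
orient-injective {i = i} {j} eq with <-cmp i j
... | tri< i<j _ _ = contradiction (trans (sym (orient-< i<j)) (trans eq (orient-≮ (<-asym i<j)))) λ ()
... | tri≈ _ i≡j _ = i≡j
... | tri> _ _ j<i = contradiction (trans (sym (orient-≮ (<-asym j<i))) (trans eq (orient-< j<i))) λ ()

_≟ᶜ_ : (c d : Color) → Dec (c ≡ d)
red  ≟ᶜ red  = yes refl
red  ≟ᶜ blue = no λ ()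
blue ≟ᶜ red  = no λ ()
blue ≟ᶜ blue = yes refl

orient-cases : ∀ {n} {a b : Fin n} → a ≢ b → ∀ c → orient a b ≡ c ⊎ orient b a ≡ c
orient-cases {a = a} {b} a≢b c with <-cmp a b | c
... | tri< a<b _ _ | red  = inj₁ (orient-< a<b)
... | tri< a<b _ _ | blue = inj₂ (orient-≮ (<-asym a<b))
... | tri≈ _ a≡b _ | _    = contradiction a≡b a≢b
... | tri> _ _ b<a | red  = inj₂ (orient-< b<a)
... | tri> _ _ b<a | blue = inj₁ (orient-≮ (<-asym b<a))

-- Hypotheses named v↑u stand for par v ≡ just u.

ParentEdge : ∀ {n} → Parent n → Fin n → Fin n → Set
ParentEdge par a b = par b ≡ just a ⊎ par a ≡ just b

HasChild : ∀ {n} → Parent n → Fin n → Set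
HasChild par v = ∃ λ u → par u ≡ just v

hasChild? : ∀ {n} (par : Parent n) → Decidable (HasChild par)
hasChild? par v = any? λ u → ≡-dec _≟_ (par u) (just v)

hasChild-transport : ∀ {n} {p q : Parent n} → (∀ v → p v ≡ q v) → ∀ {v} → HasChild p v → HasChild q v
hasChild-transport p≗q (u , u↑) = u , trans (sym (p≗q u)) u↑

steps : ∀ {n} {par : Parent n} {v r} → Reaches par v r → ℕ
steps here     = 0
steps (up _ p) = suc (steps p)

steps-unique : ∀ {n} {par : Parent n} {v r} → par r ≡ nothing → (p q : Reaches par v r) → steps p ≡ steps q
steps-unique _      here      here       = refl
steps-unique r-root here      (up r↑ _)  = contradiction (trans (sym r-root) r↑) λ ()
steps-unique r-root (up r↑ _) here       = contradiction (trans (sym r-root) r↑) λ ()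
steps-unique r-root (up v↑u p) (up v↑u′ q) with trans (sym v↑u) v↑u′
... | refl = cong suc (steps-unique r-root p q)

rootedTree : ∀ {n} {par : Parent n} r → par r ≡ nothing → (∀ v → Reaches par v r) → IsRootedTree par
rootedTree {par = par} r r-root reach = r , r-root , parentless⇒root , reach
  where
  parentless⇒root : ∀ v → par v ≡ nothing → v ≡ r
  parentless⇒root v v-root with reach v
  ... | here     = refl
  ... | up v↑ _ = contradiction (trans (sym v-root) v↑) λ ()

reaches-parent : ∀ {n} {par : Parent n} {v r} → Reaches par v r → v ≢ r → ∃ λ u → par v ≡ just u
reaches-parent here       v≢r = contradiction refl v≢r
reaches-parent (up v↑u _) _   = _ , v↑u

reaches-hasChild : ∀ {n} {par : Parent n} {v r} → Reaches par v r → v ≢ r → HasChild par r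
reaches-hasChild here v≢r = contradiction refl v≢r
reaches-hasChild {r = r} (up {u = u} v↑u u↝r) _ with u ≟ r
... | yes refl = _ , v↑u
... | no u≢r   = reaches-hasChild u↝r u≢r

reaches-snoc : ∀ {n} {par : Parent n} {v u w} → Reaches par v u → par u ≡ just w → Reaches par v w
reaches-snoc here       u↑w = up u↑w here
reaches-snoc (up v↑ p) u↑w = up v↑ (reaches-snoc p u↑w)

reaches-across : ∀ {n} {par : Parent n} {x y r} → par r ≡ nothing → ParentEdge par x y →
                 Reaches par y r → Reaches par x r
reaches-across r-root (inj₁ y↑x) here           = contradiction (trans (sym r-root) y↑x) λ ()
reaches-across r-root (inj₁ y↑x) (up y↑u u↝r) with trans (sym y↑x) y↑u
... | refl = u↝r
reaches-across _      (inj₂ x↑y) y↝r            = up x↑y y↝r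

Grounded : ∀ {n} → Parent n → Fin n → Set
Grounded par v = ∃ λ r → Reaches par v r × par r ≡ nothing

record ParentCycle {n} (par : Parent n) (c : Fin n) (cs : List (Fin n)) : Set where
  field
    distinct : Unique (c ∷ cs)
    chain    : Linked (λ a b → par b ≡ just a) (c ∷ cs)
    closing  : ∀ {x} → last (c ∷ cs) ≡ just x → par c ≡ just x

module _ {n} (par : Parent n) where

  open DecMembership (_≟_ {n}) using (_∈?_)

  -- Walk up the parent pointers, keeping the visited vertices; by
  -- pigeonhole the walk either stops at a parentless vertex or closes a cycle.
  climb : ∀ fuel {v c cs} → fuel + length (c ∷ cs) ≡ suc n →
          Unique (c ∷ cs) → Linked (λ a b → par b ≡ just a) (c ∷ cs) → Reaches par v c →
          Grounded par v ⊎ ∃₂ (ParentCycle par)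
  climb zero           eq u _ _ = contradiction (unique⇒length≤ u) (ℕ.<⇒≱ (ℕ.≤-reflexive (sym eq)))
  climb (suc fuel) {c = c} {cs} eq u l v↝c with par c in c↑
  ... | nothing = inj₁ (c , v↝c , c↑)
  ... | just x with x ∈? c ∷ cs
  ...   | no x∉  =
    climb fuel (trans (ℕ.+-suc fuel _) eq) (¬Any⇒All¬ _ x∉ ∷ u) (c↑ ∷ l) (reaches-snoc v↝c c↑)
  ...   | yes x∈ with ys , u′ , l′ , lst , _ ← prefixUpTo x∈ u l =
    inj₂ (c , ys , record { distinct = u′ ; chain = l′
                          ; closing = λ lst′ → trans c↑ (trans (sym lst) lst′) })

  grounded-or-cycle : ∀ v → Grounded par v ⊎ ∃₂ (ParentCycle par)
  grounded-or-cycle v = climb n (ℕ.+-comm n 1) ([] ∷ []) [-] here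

-- The color map

data ColorMapView {n} (par : Parent n) (i j : Fin n) : Maybe Color → Set where
  parent-child : par j ≡ just i → ColorMapView par i j (just (orient i j))
  child-parent : par j ≢ just i → par i ≡ just j → ColorMapView par i j (just (orient j i))
  unrelated    : par j ≢ just i → par i ≢ just j → ColorMapView par i j nothing

colorMapView : ∀ {n} (par : Parent n) i j → ColorMapView par i j (colorMap par i j)
colorMapView par i j with ≡-dec _≟_ (par j) (just i)
... | yes j↑i = parent-child j↑i
... | no ¬j↑i with ≡-dec _≟_ (par i) (just j)
...   | yes i↑j = child-parent ¬j↑i i↑j
...   | no ¬i↑j = unrelated ¬j↑i ¬i↑j

module _ {n} (par : Parent n) where

  parent⇒colorMap : ∀ {u v} → par v ≡ just u → colorMap par u v ≡ just (orient u v)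
  parent⇒colorMap {u} {v} v↑u with colorMap par u v | colorMapView par u v
  ... | _ | parent-child _      = refl
  ... | _ | child-parent ¬v↑u _ = contradiction v↑u ¬v↑u
  ... | _ | unrelated ¬v↑u _    = contradiction v↑u ¬v↑u

  parent⇒adj : ∀ {i j} → par j ≡ just i → Adj (colorMap par) i j
  parent⇒adj j↑i = _ , parent⇒colorMap j↑i

  child⇒adj : ∀ {i j} → par i ≡ just j → Adj (colorMap par) i j
  child⇒adj {i} {j} i↑j with colorMap par i j | colorMapView par i j
  ... | _ | parent-child _   = _ , refl
  ... | _ | child-parent _ _ = _ , refl
  ... | _ | unrelated _ ¬i↑j  = contradiction i↑j ¬i↑j

  adj⇒parentEdge : ∀ {i j} → Adj (colorMap par) i j → ParentEdge par i j
  adj⇒parentEdge {i} {j} (c , eq) with colorMap par i j | colorMapView par i j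
  ... | _ | parent-child j↑i   = inj₁ j↑i
  ... | _ | child-parent _ i↑j = inj₂ i↑j
  ... | _ | unrelated _ _      = contradiction eq λ ()

  red⇒parent : ∀ {i k} → i < k → Red (colorMap par) i k → par k ≡ just i
  red⇒parent {i} {k} i<k isRed with colorMap par i k | colorMapView par i k
  ... | _ | parent-child k↑i = k↑i
  ... | _ | child-parent _ _ = contradiction (orient-red⇒< (just-injective isRed)) (<-asym i<k)
  ... | _ | unrelated _ _    = contradiction isRed λ ()

  blue⇒child : ∀ {i k} → i < k → Blue (colorMap par) i k → par i ≡ just k
  blue⇒child {i} {k} i<k isBlue with colorMap par i k | colorMapView par i k
  ... | _ | parent-child _     = contradiction i<k (orient-blue⇒≮ (just-injective isBlue))
  ... | _ | child-parent _ i↑k = i↑k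
  ... | _ | unrelated _ _      = contradiction isBlue λ ()

  colorMap-avoids₁ : ¬ Pattern1 (colorMap par)
  colorMap-avoids₁ (i , j , k , i<j , j<k , ik , jk) =
    <-irrefl (just-injective (trans (sym (red⇒parent (<-trans i<j j<k) ik)) (red⇒parent j<k jk))) i<j

  colorMap-avoids₂ : ¬ Pattern2 (colorMap par)
  colorMap-avoids₂ (i , j , k , i<j , j<k , ij , ik) =
    <-irrefl (just-injective (trans (sym (blue⇒child i<j ij)) (blue⇒child (<-trans i<j j<k) ik))) j<k

  colorMap-avoids₃ : ¬ Pattern3 (colorMap par)
  colorMap-avoids₃ (i , j , k , i<j , j<k , ij , jk) =
    <-irrefl (just-injective (trans (sym (red⇒parent i<j ij)) (blue⇒child j<k jk))) (<-trans i<j j<k)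

colorMap-cong : ∀ {n} {p q : Parent n} → (∀ v → p v ≡ q v) → ∀ i j → colorMap p i j ≡ colorMap q i j
colorMap-cong {p = p} {q} p≗q i j with colorMap p i j | colorMapView p i j | colorMap q i j | colorMapView q i j
... | _ | parent-child _      | _ | parent-child _      = refl
... | _ | child-parent _ _    | _ | child-parent _ _    = refl
... | _ | unrelated _ _       | _ | unrelated _ _       = refl
... | _ | parent-child j↑i    | _ | child-parent ¬j↑i _ = contradiction (trans (sym (p≗q j)) j↑i) ¬j↑i
... | _ | parent-child j↑i    | _ | unrelated ¬j↑i _    = contradiction (trans (sym (p≗q j)) j↑i) ¬j↑i
... | _ | child-parent ¬j↑i _ | _ | parent-child j↑i    = contradiction (trans (p≗q j) j↑i) ¬j↑i
... | _ | child-parent _ i↑j  | _ | unrelated _ ¬i↑j    = contradiction (trans (sym (p≗q i)) i↑j) ¬i↑j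
... | _ | unrelated ¬j↑i _    | _ | parent-child j↑i    = contradiction (trans (p≗q j) j↑i) ¬j↑i
... | _ | unrelated _ ¬i↑j    | _ | child-parent _ i↑j  = contradiction (trans (p≗q i) i↑j) ¬i↑j

_++ʷ_ : ∀ {n} {g : Coloring n} {i j k} → Walk g i j → Walk g j k → Walk g i k
stop       ++ʷ w′ = w′
step a w   ++ʷ w′ = step a (w ++ʷ w′)

module RootedTree {n} {par : Parent n} (tree : IsRootedTree par) where

  root : Fin n
  root = proj₁ tree

  root-parentless : par root ≡ nothing
  root-parentless = proj₁ (proj₂ tree)

  reach : ∀ v → Reaches par v root
  reach = proj₂ (proj₂ (proj₂ tree))

  depth : Fin n → ℕ
  depth v = steps (reach v)

  depth-parent : ∀ {u v} → par u ≡ just v → depth u ≡ suc (depth v)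
  depth-parent u↑v = steps-unique root-parentless (reach _) (up u↑v (reach _))

  parent-< : ∀ {u v} → par u ≡ just v → depth v ℕ.< depth u
  parent-< u↑v = ℕ.≤-reflexive (sym (depth-parent u↑v))

  parent-irreflexive : ∀ {v} → par v ≢ just v
  parent-irreflexive v↑v = ℕ.<-irrefl refl (parent-< v↑v)

  parent≢ : ∀ {u v} → par v ≡ just u → u ≢ v
  parent≢ v↑u refl = parent-irreflexive v↑u

  parent-asymmetric : ∀ {u v} → par u ≡ just v → par v ≢ just u
  parent-asymmetric u↑v v↑u = ℕ.<-asym (parent-< u↑v) (parent-< v↑u)

  private
    g : Coloring n
    g = colorMap par

  colorMap-symmetric : ∀ i j → g i j ≡ g j i
  colorMap-symmetric i j with g i j | colorMapView par i j | g j i | colorMapView par j i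
  ... | _ | parent-child j↑i   | _ | parent-child i↑j   = contradiction i↑j (parent-asymmetric j↑i)
  ... | _ | parent-child _     | _ | child-parent _ _   = refl
  ... | _ | parent-child j↑i   | _ | unrelated _ ¬j↑i   = contradiction j↑i ¬j↑i
  ... | _ | child-parent _ _   | _ | parent-child _     = refl
  ... | _ | child-parent _ i↑j | _ | child-parent ¬i↑j _ = contradiction i↑j ¬i↑j
  ... | _ | child-parent _ i↑j | _ | unrelated ¬i↑j _   = contradiction i↑j ¬i↑j
  ... | _ | unrelated _ ¬i↑j   | _ | parent-child i↑j   = contradiction i↑j ¬i↑j
  ... | _ | unrelated ¬j↑i _   | _ | child-parent _ j↑i = contradiction j↑i ¬j↑i
  ... | _ | unrelated _ _      | _ | unrelated _ _      = refl

  colorMap-irreflexive : ∀ i → g i i ≡ nothing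
  colorMap-irreflexive i with g i i | colorMapView par i i
  ... | _ | parent-child i↑i   = contradiction i↑i parent-irreflexive
  ... | _ | child-parent _ i↑i = contradiction i↑i parent-irreflexive
  ... | _ | unrelated _ _      = refl

  walk-up : ∀ {v r} → Reaches par v r → Walk g v r
  walk-up here       = stop
  walk-up (up v↑u p) = step (child⇒adj par v↑u) (walk-up p)

  walk-down : ∀ {v r} → Reaches par v r → Walk g r v
  walk-down here       = stop
  walk-down (up v↑u p) = walk-down p ++ʷ step (parent⇒adj par v↑u) stop

  colorMap-connected : ∀ i j → Walk g i j
  colorMap-connected i j = walk-up (reach i) ++ʷ walk-down (reach j)

  -- A simple path in a rooted tree never steps down and then up again, since
  -- both neighbours of the turning vertex would be its parent.
  descent : ∀ {x y xs z} → par y ≡ just x → Connected _≢_ (just x) (head xs) →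
            Unique (y ∷ xs) → Linked (ParentEdge par) (y ∷ xs) → last (y ∷ xs) ≡ just z →
            depth x ℕ.< depth z
  descent y↑x _ _ [-] refl = parent-< y↑x
  descent y↑x (just x≢y′) (y∉ ∷ u) (inj₁ y′↑y ∷ l) lst =
    ℕ.<-trans (parent-< y↑x) (descent y′↑y (all⇒connected (All.tail y∉)) u l lst)
  descent y↑x (just x≢y′) _ (inj₂ y↑y′ ∷ _) _ =
    contradiction (just-injective (trans (sym y↑x) y↑y′)) x≢y′

  ascent : ∀ {x xs y z} → Unique (x ∷ xs) → Linked (ParentEdge par) (x ∷ xs) → z ∉ x ∷ xs →
           last (x ∷ xs) ≡ just y → par y ≡ just z →
           depth z ℕ.< depth x × Connected (λ a b → par a ≡ just b) (just x) (head xs)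
  ascent _ [-] _ refl y↑z = parent-< y↑z , just-nothing
  ascent _ (e ∷ [-]) z∉ refl y↑z with e
  ... | inj₂ x↑y = ℕ.<-trans (parent-< y↑z) (parent-< x↑y) , just x↑y
  ... | inj₁ y↑x = contradiction (just-injective (trans (sym y↑x) y↑z)) λ x≡z → z∉ (here (sym x≡z))
  ascent ((_ ∷ x≢x″ ∷ _) ∷ u) (e ∷ l@(_ ∷ _)) z∉ lst y↑z with ascent u l (z∉ ∘ there) lst y↑z | e
  ... | z<x′ , _          | inj₂ x↑x′ = ℕ.<-trans z<x′ (parent-< x↑x′) , just x↑x′
  ... | _ , just x′↑x″    | inj₁ x′↑x =
    contradiction (just-injective (trans (sym x′↑x) x′↑x″)) x≢x″

  colorMap-acyclic : ∀ vs → ¬ IsCycle g vs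
  colorMap-acyclic (v₀ ∷ v₁ ∷ v₂ ∷ vs) cycle =
    closing-contradiction (adj⇒parentEdge par (closing v₀ vₖ refl lst))
    where
    open IsCycle cycle
    vₖ : Fin n
    vₖ = proj₁ (last-∷ v₂ vs)
    lst : last (v₂ ∷ vs) ≡ just vₖ
    lst = proj₂ (last-∷ v₂ vs)
    v₀∉ : All (v₀ ≢_) (v₁ ∷ v₂ ∷ vs)
    v₀∉ = AllPairs.head distinct
    v₁∉ : All (v₁ ≢_) (v₂ ∷ vs)
    v₁∉ = AllPairs.head (AllPairs.tail distinct)
    edges : Linked (ParentEdge par) (v₀ ∷ v₁ ∷ v₂ ∷ vs)
    edges = Linked.map (adj⇒parentEdge par) path
    closing-contradiction : ParentEdge par vₖ v₀ → ⊥
    closing-contradiction (inj₁ v₀↑vₖ) =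
      ℕ.<-irrefl refl (descent v₀↑vₖ vₖ≢v₁ distinct edges lst)
      where
      vₖ≢v₁ : Connected _≢_ (just vₖ) (just v₁)
      vₖ≢v₁ = just λ vₖ≡v₁ → All.lookup v₁∉ (last-∈ vs lst) (sym vₖ≡v₁)
    closing-contradiction (inj₂ vₖ↑v₀)
      with ascent (AllPairs.tail distinct) (Linked.tail edges) (All¬⇒¬Any v₀∉) lst vₖ↑v₀ | Linked.head edges
    ... | v₀<v₁ , _      | inj₂ v₀↑v₁ = ℕ.<-asym v₀<v₁ (parent-< v₀↑v₁)
    ... | _ , just v₁↑v₂ | inj₁ v₁↑v₀ =
      All.head (All.tail v₀∉) (just-injective (trans (sym v₁↑v₀) v₁↑v₂))
  colorMap-acyclic (_ ∷ _ ∷ []) cycle with IsCycle.long cycle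
  ... | s≤s (s≤s ())
  colorMap-acyclic (_ ∷ []) cycle with IsCycle.long cycle
  ... | s≤s ()
  colorMap-acyclic [] cycle with IsCycle.long cycle
  ... | ()

  colorMap-inGbar : InGbar g
  colorMap-inGbar =
    record { symmetric = colorMap-symmetric ; irreflexive = colorMap-irreflexive
           ; connected = colorMap-connected ; acyclic = colorMap-acyclic }
    , colorMap-avoids₁ par , colorMap-avoids₂ par , colorMap-avoids₃ par

deepest-childless : ∀ {n} {par : Parent n} (tree : IsRootedTree par) → ∃ λ v → ¬ HasChild par v
deepest-childless {n} tree = deepest , λ (u , u↑) →
    ℕ.<⇒≱ (parent-< u↑) (All.lookup (f[xs]≤f[argmax] {f = depth} root (allFin n)) (∈-allFin u))
  where
  open RootedTree tree
  deepest : Fin n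
  deepest = argmax depth root (allFin n)

childless≢root : ∀ {m} {T : Parent (suc (suc m))} (tree : IsRootedTree T) {ℓ} →
                 ¬ HasChild T ℓ → ℓ ≢ RootedTree.root tree
childless≢root tree ℓ-leaf refl = ℓ-leaf (reaches-hasChild (reach (punchIn root zero)) (punchInᵢ≢i root zero))
  where open RootedTree tree

parent-transfer : ∀ {n} (p q : Parent n) → IsRootedTree p → (∀ i j → colorMap p i j ≡ colorMap q i j) →
                  ∀ {u v} → p v ≡ just u → q v ≡ just u
parent-transfer p q tree same {u} {v} v↑u with colorMap q u v | colorMapView q u v | same u v
... | _ | parent-child qv↑u | _ = qv↑u
... | _ | child-parent _ _  | eq =
  contradiction (orient-injective (just-injective (trans (sym (parent⇒colorMap p v↑u)) eq)))
                (RootedTree.parent≢ tree v↑u)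
... | _ | unrelated _ _     | eq = contradiction (trans (sym (parent⇒colorMap p v↑u)) eq) λ ()

colorMap-injective : ∀ {n} (p q : Parent n) → IsRootedTree p → IsRootedTree q →
                     (∀ i j → colorMap p i j ≡ colorMap q i j) → ∀ v → p v ≡ q v
colorMap-injective p q p-tree q-tree same v = agree (p v) (q v) refl refl
  where
  agree : ∀ x y → p v ≡ x → q v ≡ y → x ≡ y
  agree (just u) _        pv qv = trans (sym (parent-transfer p q p-tree same pv)) qv
  agree nothing  nothing  _  _  = refl
  agree nothing  (just u) pv qv =
    contradiction (trans (sym pv) (parent-transfer q p q-tree (λ i j → sym (same i j)) qv)) λ ()

-- Inverting the color map

module Inverse {m} (g : Coloring (suc m)) (g∈ : InGbar g) where

  open IsTwoColoredTree (proj₁ g∈)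

  private
    n : ℕ
    n = suc m

    avoids₁ : ¬ Pattern1 g
    avoids₁ = proj₁ (proj₂ g∈)

    avoids₂ : ¬ Pattern2 g
    avoids₂ = proj₁ (proj₂ (proj₂ g∈))

    avoids₃ : ¬ Pattern3 g
    avoids₃ = proj₂ (proj₂ (proj₂ g∈))

  IsParent : Fin n → Fin n → Set
  IsParent u v = g u v ≡ just (orient u v)

  no-loop : ∀ {a c} → g a a ≢ just c
  no-loop {a} aa = contradiction (trans (sym (irreflexive a)) aa) λ ()

  red-parent : ∀ {u v} → u < v → IsParent u v → Red g u v
  red-parent u<v u↑ = trans u↑ (cong just (orient-< u<v))

  blue-parent : ∀ {u v} → v < u → IsParent u v → Blue g v u
  blue-parent v<u u↑ = trans (symmetric _ _) (trans u↑ (cong just (orient-≮ (<-asym v<u))))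

  -- Two parents of v, ordered with v, always form one of the forbidden patterns.
  no-two-parents : ∀ {u u′ v} → u < u′ → IsParent u v → ¬ IsParent u′ v
  no-two-parents {u} {u′} {v} u<u′ u↑ u′↑ with <-cmp u v | <-cmp u′ v
  ... | tri≈ _ refl _ | _             = no-loop u↑
  ... | _             | tri≈ _ refl _ = no-loop u′↑
  ... | tri< u<v _ _  | tri< u′<v _ _ = avoids₁ (u , u′ , v , u<u′ , u′<v , red-parent u<v u↑ , red-parent u′<v u′↑)
  ... | tri< u<v _ _  | tri> _ _ v<u′ = avoids₃ (u , v , u′ , u<v , v<u′ , red-parent u<v u↑ , blue-parent v<u′ u′↑)
  ... | tri> _ _ v<u  | tri< u′<v _ _ = <-asym u<u′ (<-trans u′<v v<u)
  ... | tri> _ _ v<u  | tri> _ _ v<u′ = avoids₂ (v , u , u′ , v<u , u<u′ , blue-parent v<u u↑ , blue-parent v<u′ u′↑)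

  parent-unique : ∀ {u u′ v} → IsParent u v → IsParent u′ v → u ≡ u′
  parent-unique {u} {u′} u↑ u′↑ with <-cmp u u′
  ... | tri< u<u′ _ _ = contradiction u′↑ (no-two-parents u<u′ u↑)
  ... | tri≈ _ u≡u′ _ = u≡u′
  ... | tri> _ _ u′<u = contradiction u↑ (no-two-parents u′<u u′↑)

  par : Parent n
  par v with any? (λ u → ≡-dec _≟ᶜ_ (g u v) (just (orient u v)))
  ... | yes (u , _) = just u
  ... | no _        = nothing

  par-sound : ∀ {u v} → par v ≡ just u → IsParent u v
  par-sound {u} {v} v↑u with any? (λ u → ≡-dec _≟ᶜ_ (g u v) (just (orient u v)))
  ... | yes (_ , u′↑) = subst (λ w → IsParent w v) (just-injective v↑u) u′↑
  ... | no _          = contradiction v↑u λ ()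

  par-complete : ∀ {u v} → IsParent u v → par v ≡ just u
  par-complete {u} {v} u↑ with any? (λ u → ≡-dec _≟ᶜ_ (g u v) (just (orient u v)))
  ... | yes (_ , u′↑) = cong just (parent-unique u′↑ u↑)
  ... | no none       = contradiction (u , u↑) none

  edge⇒parentEdge : ∀ {a b c} → g a b ≡ just c → ParentEdge par a b
  edge⇒parentEdge {a} {b} {c} ab with orient-cases {a = a} {b} (λ { refl → no-loop ab }) c
  ... | inj₁ refl = inj₁ (par-complete ab)
  ... | inj₂ refl = inj₂ (par-complete (trans (symmetric b a) ab))

  unrelated⇒no-edge : ∀ {i j} → par j ≢ just i → par i ≢ just j → g i j ≡ nothing
  unrelated⇒no-edge {i} {j} ¬j↑i ¬i↑j = absent (g i j) refl
    where
    absent : ∀ x → g i j ≡ x → x ≡ nothing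
    absent nothing  _  = refl
    absent (just _) ij with edge⇒parentEdge ij
    ... | inj₁ j↑i = contradiction j↑i ¬j↑i
    ... | inj₂ i↑j = contradiction i↑j ¬i↑j

  colorMap-par : ∀ i j → colorMap par i j ≡ g i j
  colorMap-par i j with colorMap par i j | colorMapView par i j
  ... | _ | parent-child j↑i   = sym (par-sound j↑i)
  ... | _ | child-parent _ i↑j = sym (trans (symmetric i j) (par-sound i↑j))
  ... | _ | unrelated ¬j↑i ¬i↑j = sym (unrelated⇒no-edge ¬j↑i ¬i↑j)

  no-parentCycle : ∀ {c cs} → ¬ ParentCycle par c cs
  no-parentCycle {c} {[]} cycle = no-loop (par-sound (ParentCycle.closing cycle refl))
  no-parentCycle {c} {y ∷ []} record { distinct = (c≢y ∷ []) ∷ _ ; chain = y↑c ∷ [-] ; closing = closing } =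
    c≢y (sym (orient-injective (just-injective
      (trans (sym (par-sound (closing refl))) (trans (symmetric y c) (par-sound y↑c))))))
  no-parentCycle {c} {y ∷ y′ ∷ cs} cycle = acyclic (c ∷ y ∷ y′ ∷ cs) record
    { long     = s≤s (s≤s (s≤s z≤n))
    ; distinct = distinct
    ; path     = Linked.map (λ b↑a → _ , par-sound b↑a) chain
    ; closing  = λ { _ b refl lst → _ , par-sound (closing lst) } }
    where open ParentCycle cycle

  par-rooted : IsRootedTree par
  par-rooted with grounded-or-cycle par zero
  ... | inj₂ (_ , _ , cycle)    = contradiction cycle no-parentCycle
  ... | inj₁ (r , 0↝r , r-root) = rootedTree r r-root λ v → along (connected v zero) 0↝r
    where
    along : ∀ {x y} → Walk g x y → Reaches par y r → Reaches par x r
    along stop              y↝r = y↝r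
    along (step (_ , xy) w) y↝r = reaches-across r-root (edge⇒parentEdge xy) (along w y↝r)

-- Prüfer codes

data Punched {n} (ℓ : Fin (suc n)) : Fin (suc n) → Set where
  hole    : Punched ℓ ℓ
  punched : ∀ k → Punched ℓ (punchIn ℓ k)

punched? : ∀ {n} (ℓ v : Fin (suc n)) → Punched ℓ v
punched? ℓ v with ℓ ≟ v
... | yes refl = hole
... | no ℓ≢v   = subst (Punched ℓ) (punchIn-punchOut ℓ≢v) (punched _)

punchOut-cong₂ : ∀ {n} {i i′ j j′ : Fin (suc n)} {i≢j : i ≢ j} {i′≢j′ : i′ ≢ j′} →
                 i ≡ i′ → j ≡ j′ → punchOut i≢j ≡ punchOut i′≢j′
punchOut-cong₂ {i = i} refl j≡j′ = punchOut-cong i j≡j′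

punchOut-injective₂ : ∀ {n} {i i′ j j′ : Fin (suc n)} {i≢j : i ≢ j} {i′≢j′ : i′ ≢ j′} →
                      i ≡ i′ → punchOut i≢j ≡ punchOut i′≢j′ → j ≡ j′
punchOut-injective₂ {i≢j = i≢j} {i′≢j′} refl = punchOut-injective i≢j i′≢j′

lower : ∀ {n} → Fin (suc n) → Fin (suc n) → Maybe (Fin n)
lower ℓ v with ℓ ≟ v
... | yes _   = nothing
... | no ℓ≢v = just (punchOut ℓ≢v)

lower-hole : ∀ {n} (ℓ : Fin (suc n)) → lower ℓ ℓ ≡ nothing
lower-hole ℓ with ℓ ≟ ℓ
... | yes _   = refl
... | no ℓ≢ℓ = contradiction refl ℓ≢ℓ

lower-punchIn : ∀ {n} (ℓ : Fin (suc n)) k → lower ℓ (punchIn ℓ k) ≡ just k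
lower-punchIn ℓ k with ℓ ≟ punchIn ℓ k
... | yes ℓ≡ = contradiction (sym ℓ≡) (punchInᵢ≢i ℓ k)
... | no _   = cong just (trans (punchOut-cong ℓ refl) (punchOut-punchIn ℓ))

-- attach ℓ x D hangs the new leaf ℓ below x and renumbers the vertices of D by
-- punchIn ℓ; prune ℓ T undoes this when ℓ is childless in T.
attach : ∀ {n} → Fin (suc n) → Fin (suc n) → Parent n → Parent (suc n)
attach ℓ x D v = maybe (Maybe.map (punchIn ℓ) ∘ D) (just x) (lower ℓ v)

prune : ∀ {n} → Fin (suc n) → Parent (suc n) → Parent n
prune ℓ T k = T (punchIn ℓ k) >>= lower ℓ

module _ {n} (ℓ x : Fin (suc n)) (D : Parent n) where

  attach-hole : attach ℓ x D ℓ ≡ just x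
  attach-hole = cong (maybe _ _) (lower-hole ℓ)

  attach-punchIn : ∀ k → attach ℓ x D (punchIn ℓ k) ≡ Maybe.map (punchIn ℓ) (D k)
  attach-punchIn k = cong (maybe _ _) (lower-punchIn ℓ k)

  attach-hasChild-hole : x ≢ ℓ → ¬ HasChild (attach ℓ x D) ℓ
  attach-hasChild-hole x≢ℓ (u , u↑ℓ) with punched? ℓ u
  ... | hole      = x≢ℓ (just-injective (trans (sym attach-hole) u↑ℓ))
  ... | punched k =
    punchInᵢ≢i ℓ _ (proj₂ (proj₂ (map-just {f = punchIn ℓ} {m = D k} (trans (sym (attach-punchIn k)) u↑ℓ))))

  attach-hasChild-punchIn : ∀ k → HasChild (attach ℓ x D) (punchIn ℓ k) ⇔ (x ≡ punchIn ℓ k ⊎ HasChild D k)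
  attach-hasChild-punchIn k = mk⇔ to from
    where
    to : HasChild (attach ℓ x D) (punchIn ℓ k) → x ≡ punchIn ℓ k ⊎ HasChild D k
    to (u , u↑) with punched? ℓ u
    ... | hole       = inj₁ (just-injective (trans (sym attach-hole) u↑))
    ... | punched u′ = inj₂ (u′ , map-injective (punchIn-injective ℓ _ _) (trans (sym (attach-punchIn u′)) u↑))

    from : x ≡ punchIn ℓ k ⊎ HasChild D k → HasChild (attach ℓ x D) (punchIn ℓ k)
    from (inj₁ x≡)        = ℓ , trans attach-hole (cong just x≡)
    from (inj₂ (u , u↑k)) = punchIn ℓ u , trans (attach-punchIn u) (cong (Maybe.map _) u↑k)

attach-cong : ∀ {n} {ℓ ℓ′ x x′ : Fin (suc n)} {D D′ : Parent n} →
              ℓ ≡ ℓ′ → x ≡ x′ → (∀ k → D k ≡ D′ k) →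
              ∀ v → attach ℓ x D v ≡ attach ℓ′ x′ D′ v
attach-cong {ℓ = ℓ} {x = x} {D = D} {D′} refl refl D≗D′ v with punched? ℓ v
... | hole      = trans (attach-hole ℓ x D) (sym (attach-hole ℓ x D′))
... | punched k =
  trans (attach-punchIn ℓ x D k) (trans (cong (Maybe.map _) (D≗D′ k)) (sym (attach-punchIn ℓ x D′ k)))

attach-injective : ∀ {n} {ℓ x x′ : Fin (suc n)} {D D′ : Parent n} →
                   (∀ v → attach ℓ x D v ≡ attach ℓ x′ D′ v) →
                   x ≡ x′ × (∀ k → D k ≡ D′ k)
attach-injective {ℓ = ℓ} {x} {x′} {D} {D′} same =
    just-injective (trans (sym (attach-hole ℓ x D)) (trans (same ℓ) (attach-hole ℓ x′ D′)))
  , λ k → map-injective (punchIn-injective ℓ _ _)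
            (trans (sym (attach-punchIn ℓ x D k)) (trans (same (punchIn ℓ k)) (attach-punchIn ℓ x′ D′ k)))

attach-rooted : ∀ {n} {ℓ x : Fin (suc n)} {D : Parent n} →
                x ≢ ℓ → IsRootedTree D → IsRootedTree (attach ℓ x D)
attach-rooted {ℓ = ℓ} {x} {D} x≢ℓ (r , r-root , _ , reach) =
  rootedTree (punchIn ℓ r) (trans (attach-punchIn ℓ x D r) (cong (Maybe.map _) r-root)) reach′
  where
  lift : ∀ {k s} → Reaches D k s → Reaches (attach ℓ x D) (punchIn ℓ k) (punchIn ℓ s)
  lift here        = here
  lift (up k↑u p) = up (trans (attach-punchIn ℓ x D _) (cong (Maybe.map _) k↑u)) (lift p)

  reach′ : ∀ v → Reaches (attach ℓ x D) v (punchIn ℓ r)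
  reach′ v with punched? ℓ v | punched? ℓ x
  ... | punched k | _          = lift (reach k)
  ... | hole      | hole       = contradiction refl x≢ℓ
  ... | hole      | punched k  = up (attach-hole ℓ _ D) (lift (reach k))

module _ {n} {ℓ : Fin (suc n)} {T : Parent (suc n)} (ℓ-leaf : ¬ HasChild T ℓ) where

  prune-punchIn : ∀ {k u} → T (punchIn ℓ k) ≡ just (punchIn ℓ u) → prune ℓ T k ≡ just u
  prune-punchIn {k} {u} k↑u = trans (cong (_>>= lower ℓ) k↑u) (lower-punchIn ℓ u)

  attach-prune : ∀ {x} → T ℓ ≡ just x → ∀ v → attach ℓ x (prune ℓ T) v ≡ T v
  attach-prune {x} ℓ↑x v with punched? ℓ v
  ... | hole      = trans (attach-hole ℓ x (prune ℓ T)) (sym ℓ↑x)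
  ... | punched k = trans (attach-punchIn ℓ x (prune ℓ T) k) (restore (T (punchIn ℓ k)) refl)
    where
    restore : ∀ y → T (punchIn ℓ k) ≡ y → Maybe.map (punchIn ℓ) (prune ℓ T k) ≡ y
    restore nothing  k↑ = cong (λ z → Maybe.map (punchIn ℓ) (z >>= lower ℓ)) k↑
    restore (just u) k↑ with punched? ℓ u
    ... | hole       = contradiction (_ , k↑) ℓ-leaf
    ... | punched u′ = cong (Maybe.map (punchIn ℓ)) (prune-punchIn k↑)

  prune-reaches : ∀ {v r} → Reaches T v r →
                  ∀ {k s} → v ≡ punchIn ℓ k → r ≡ punchIn ℓ s → Reaches (prune ℓ T) k s
  prune-reaches here refl r≡ = subst (Reaches _ _) (punchIn-injective ℓ _ _ r≡) here
  prune-reaches (up {u = u} v↑u p) refl r≡ with punched? ℓ u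
  ... | hole       = contradiction (_ , v↑u) ℓ-leaf
  ... | punched u′ = up (prune-punchIn v↑u) (prune-reaches p refl r≡)

  prune-rooted : ∀ {x} → T ℓ ≡ just x → IsRootedTree T → IsRootedTree (prune ℓ T)
  prune-rooted ℓ↑x (r , r-root , _ , reach) with punched? ℓ r
  ... | hole      = contradiction (trans (sym r-root) ℓ↑x) λ ()
  ... | punched s = rootedTree s (cong (_>>= lower ℓ) r-root) λ k → prune-reaches (reach (punchIn ℓ k)) refl refl

Code : ℕ → Set
Code m = Fin m → Fin (suc m)

Occurs : ∀ {m n} → (Fin m → Fin n) → Fin n → Set
Occurs c v = ∃ λ i → c i ≡ v

occurs? : ∀ {m n} (c : Fin m → Fin n) → Decidable (Occurs c)
occurs? c v = any? λ i → c i ≟ v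

occurs-∷ : ∀ {m n} (c : Fin (suc m) → Fin n) {v} → Occurs c v ⇔ (c zero ≡ v ⊎ Occurs (c ∘ suc) v)
occurs-∷ c = mk⇔ (λ { (zero , eq) → inj₁ eq ; (suc i , eq) → inj₂ (i , eq) })
                 (λ { (inj₁ eq) → zero , eq ; (inj₂ (i , eq)) → suc i , eq })

-- If every vertex occurred, picking an occurrence of each would inject
-- Fin (suc m) into Fin m.
missingVertex : ∀ {m} (c : Code m) → ∃ λ v → ¬ Occurs c v
missingVertex {m} c = ¬∀⟶∃¬ (suc m) (Occurs c) (occurs? c) λ all →
  ℕ.<-irrefl refl (injective⇒≤ {f = proj₁ ∘ all} λ {v} {w} eq →
    trans (sym (proj₂ (all v))) (trans (cong c eq) (proj₂ (all w))))

firstLeaf : ∀ {m} → Code m → Fin (suc m)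
firstLeaf c = proj₁ (least (¬? ∘ occurs? c) (missingVertex c))

firstLeaf-least : ∀ {m} (c : Code m) → Least (¬_ ∘ Occurs c) (firstLeaf c)
firstLeaf-least c = proj₂ (least (¬? ∘ occurs? c) (missingVertex c))

firstLeaf-cong : ∀ {m} {c d : Code m} → (∀ {v} → Occurs c v ⇔ Occurs d v) → firstLeaf c ≡ firstLeaf d
firstLeaf-cong c⇔d = Least-unique (λ ¬c → ¬c ∘ Equivalence.from c⇔d) (λ ¬d → ¬d ∘ Equivalence.to c⇔d)
                                  (firstLeaf-least _) (firstLeaf-least _)

firstLeaf≢ : ∀ {m} (c : Code m) i → firstLeaf c ≢ c i
firstLeaf≢ c i ℓ≡ = proj₁ (firstLeaf-least c) (i , sym ℓ≡)

dropLeaf : ∀ {m} → Code (suc m) → Code m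
dropLeaf c i = punchOut (firstLeaf≢ c (suc i))

occurs-dropLeaf : ∀ {m} (c : Code (suc m)) {k} → Occurs (dropLeaf c) k ⇔ Occurs (c ∘ suc) (punchIn (firstLeaf c) k)
occurs-dropLeaf c = mk⇔ (λ { (i , refl) → i , sym (punchIn-punchOut _) })
                        (λ { (i , eq) → i , trans (punchOut-cong (firstLeaf c) eq) (punchOut-punchIn (firstLeaf c)) })

-- Prüfer decoding: the first vertex missing from the code is a leaf whose
-- parent is the first letter of the code
decode : ∀ {m} → Code m → Parent (suc m)
decode {zero}  _ _ = nothing
decode {suc m} c   = attach (firstLeaf c) (c zero) (decode (dropLeaf c))

decode-rooted : ∀ {m} (c : Code m) → IsRootedTree (decode c)
decode-rooted {zero}  c = rootedTree zero refl λ { zero → here ; (suc ()) }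
decode-rooted {suc m} c = attach-rooted (firstLeaf≢ c zero ∘ sym) (decode-rooted (dropLeaf c))

decode-children : ∀ {m} (c : Code m) v → HasChild (decode c) v ⇔ Occurs c v
decode-children {zero}  c v = mk⇔ (λ { (_ , ()) }) (λ { (() , _) })
decode-children {suc m} c v = by-view (punched? ℓ v)
  where
  open SetoidReasoning (⇔-setoid 0ℓ)
  ℓ : Fin (suc (suc m))
  ℓ = firstLeaf c
  D : Parent (suc m)
  D = decode (dropLeaf c)

  by-view : ∀ {v} → Punched ℓ v → HasChild (decode c) v ⇔ Occurs c v
  by-view hole        = mk⇔ (⊥-elim ∘ attach-hasChild-hole ℓ (c zero) D (firstLeaf≢ c zero ∘ sym))
                            (⊥-elim ∘ proj₁ (firstLeaf-least c))
  by-view (punched k) = begin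
    HasChild (decode c) (punchIn ℓ k)                        ≈⟨ attach-hasChild-punchIn ℓ (c zero) D k ⟩
    (c zero ≡ punchIn ℓ k ⊎ HasChild D k)                    ≈⟨ ⇔-id _ ⊎-⇔ decode-children (dropLeaf c) k ⟩
    (c zero ≡ punchIn ℓ k ⊎ Occurs (dropLeaf c) k)           ≈⟨ ⇔-id _ ⊎-⇔ occurs-dropLeaf c ⟩
    (c zero ≡ punchIn ℓ k ⊎ Occurs (c ∘ suc) (punchIn ℓ k))  ≈⟨ occurs-∷ c ⟨
    Occurs c (punchIn ℓ k)                                   ∎

decode-cong : ∀ {m} {c d : Code m} → (∀ i → c i ≡ d i) → ∀ v → decode c v ≡ decode d v
decode-cong {zero}          _   _ = refl
decode-cong {suc m} {c} {d} c≗d   =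
  attach-cong ℓ≡ (c≗d zero) (decode-cong λ i → punchOut-cong₂ ℓ≡ (c≗d (suc i)))
  where
  ℓ≡ : firstLeaf c ≡ firstLeaf d
  ℓ≡ = firstLeaf-cong (mk⇔ (λ (i , eq) → i , trans (sym (c≗d i)) eq) (λ (i , eq) → i , trans (c≗d i) eq))

decode-firstLeaf : ∀ {m} {c d : Code m} → (∀ v → decode c v ≡ decode d v) → firstLeaf c ≡ firstLeaf d
decode-firstLeaf {c = c} {d} same = firstLeaf-cong (mk⇔ (transfer c d same) (transfer d c (sym ∘ same)))
  where
  transfer : ∀ c d → (∀ v → decode c v ≡ decode d v) → ∀ {v} → Occurs c v → Occurs d v
  transfer c d same =
    Equivalence.to (decode-children d _) ∘ hasChild-transport same ∘ Equivalence.from (decode-children c _)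

decode-injective : ∀ {m} {c d : Code m} → (∀ v → decode c v ≡ decode d v) → ∀ i → c i ≡ d i
decode-injective {zero}  _ ()
decode-injective {suc m} {c} {d} same = λ where
    zero    → proj₁ split
    (suc i) → punchOut-injective₂ ℓ≡ (decode-injective (proj₂ split) i)
  where
  ℓ≡ : firstLeaf c ≡ firstLeaf d
  ℓ≡ = decode-firstLeaf {c = c} {d} same
  split : c zero ≡ d zero × (∀ k → decode (dropLeaf c) k ≡ decode (dropLeaf d) k)
  split = attach-injective {ℓ = firstLeaf c} {D = decode (dropLeaf c)} {D′ = decode (dropLeaf d)}
            λ v → trans (same v) (attach-cong {D = decode (dropLeaf d)} (sym ℓ≡) refl (λ _ → refl) v)

module _ {m} {T : Parent (suc (suc m))} {ℓ x : Fin (suc (suc m))} {c′ : Code m}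
         (ℓ-first : Least (¬_ ∘ HasChild T) ℓ) (x≢ℓ : x ≢ ℓ) (ℓ↑x : T ℓ ≡ just x)
         (c′-prune : ∀ k → decode c′ k ≡ prune ℓ T k) where

  private
    c : Code (suc m)
    c = x ◂ punchIn ℓ ∘ c′

    T-attach : ∀ v → T v ≡ attach ℓ x (prune ℓ T) v
    T-attach v = sym (attach-prune (proj₁ ℓ-first) ℓ↑x v)

    children-occur : ∀ {u} → HasChild T u → Occurs c u
    children-occur {u} u-parent with punched? ℓ u
    ... | hole      = ⊥-elim (attach-hasChild-hole ℓ x (prune ℓ T) x≢ℓ (hasChild-transport T-attach u-parent))
    ... | punched k
      with Equivalence.to (attach-hasChild-punchIn ℓ x (prune ℓ T) k) (hasChild-transport T-attach u-parent)
    ...   | inj₁ x≡ = zero , x≡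
    ...   | inj₂ k-parent with Equivalence.to (decode-children c′ k) (hasChild-transport (sym ∘ c′-prune) k-parent)
    ...     | i , eq = suc i , cong (punchIn ℓ) eq

    firstLeaf≡ℓ : firstLeaf c ≡ ℓ
    firstLeaf≡ℓ = Least-unique (λ z → z) (λ z → z) (firstLeaf-least c)
      ( (λ { (zero , x≡ℓ) → x≢ℓ x≡ℓ ; (suc i , eq) → punchInᵢ≢i ℓ _ eq })
      , λ u<ℓ ¬occurs → proj₂ ℓ-first u<ℓ (¬occurs ∘ children-occur) )

    decode-dropLeaf : ∀ k → decode (dropLeaf c) k ≡ prune ℓ T k
    decode-dropLeaf k = trans (decode-cong dropLeaf≗c′ k) (c′-prune k)
      where
      dropLeaf≗c′ : ∀ i → dropLeaf c i ≡ c′ i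
      dropLeaf≗c′ i = trans (punchOut-cong₂ firstLeaf≡ℓ refl) (punchOut-punchIn ℓ)

  decode-unprune : ∀ v → decode (x ◂ punchIn ℓ ∘ c′) v ≡ T v
  decode-unprune v =
    trans (attach-cong {D = decode (dropLeaf c)} {D′ = prune ℓ T} firstLeaf≡ℓ refl decode-dropLeaf v)
          (sym (T-attach v))

-- Prüfer encoding: remove the first childless vertex ℓ, record its parent x,
-- and encode the rest of the tree renumbered by punchOut ℓ
decode-surjective : ∀ {m} (T : Parent (suc m)) → IsRootedTree T → ∃ λ c → ∀ v → decode c v ≡ T v
decode-surjective {zero}  T (zero , r-root , _) = (λ ()) , λ { zero → sym r-root ; (suc ()) }
decode-surjective {suc m} T tree = encode (least (¬? ∘ hasChild? T) (deepest-childless tree))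
  where
  encode : ∃ (Least (¬_ ∘ HasChild T)) → ∃ λ c → ∀ v → decode c v ≡ T v
  encode (ℓ , ℓ-first) =
    x ◂ punchIn ℓ ∘ proj₁ rest , decode-unprune ℓ-first (RootedTree.parent≢ tree ℓ↑x) ℓ↑x (proj₂ rest)
    where
    parent : ∃ λ x → T ℓ ≡ just x
    parent = reaches-parent (RootedTree.reach tree ℓ) (childless≢root tree (proj₁ ℓ-first))
    x : Fin (suc (suc m))
    x = proj₁ parent
    ℓ↑x : T ℓ ≡ just x
    ℓ↑x = proj₂ parent
    rest : ∃ λ c′ → ∀ k → decode c′ k ≡ prune ℓ T k
    rest = decode-surjective (prune ℓ T) (prune-rooted (proj₁ ℓ-first) ℓ↑x tree)

funToFin-cong : ∀ {k m} {f g : Fin k → Fin m} → (∀ i → f i ≡ g i) → funToFin f ≡ funToFin g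
funToFin-cong {zero}  _   = refl
funToFin-cong {suc k} f≗g = cong₂ combine (f≗g zero) (funToFin-cong (f≗g ∘ suc))

codeTree : ∀ m → Fin (suc m ^ m) → Parent (suc m)
codeTree m k = decode (finToFun k)

codeTree-rooted : ∀ {m} (k : Fin (suc m ^ m)) → IsRootedTree (codeTree m k)
codeTree-rooted k = decode-rooted (finToFun k)

codeTree-injective : ∀ {m} (k l : Fin (suc m ^ m)) → (∀ v → codeTree m k v ≡ codeTree m l v) → k ≡ l
codeTree-injective {m} k l same =
  trans (sym (funToFin-finToFin {m} {suc m} k))
        (trans (funToFin-cong (decode-injective same)) (funToFin-finToFin {m} {suc m} l))

codeTree-surjective : ∀ {m} (T : Parent (suc m)) → IsRootedTree T → ∃ λ k → ∀ v → codeTree m k v ≡ T v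
codeTree-surjective T tree with c , c≗T ← decode-surjective T tree =
  funToFin c , λ v → trans (decode-cong (finToFun-funToFin c) v) (c≗T v)

lemma2p4 : (n : ℕ) → 1 ≤ n →
  ((par : Parent n) → IsRootedTree par → InGbar (colorMap par))
  × ((p q : Parent n) → IsRootedTree p → IsRootedTree q →
      (∀ i j → colorMap p i j ≡ colorMap q i j) → ∀ v → p v ≡ q v)
  × ((g : Coloring n) → InGbar g →
      Σ[ par ∈ Parent n ] (IsRootedTree par × (∀ i j → colorMap par i j ≡ g i j)))
  × (Σ[ f ∈ (Fin (n ^ (n ∸ 1)) → Coloring n) ]
      (((k : Fin (n ^ (n ∸ 1))) → InGbar (f k))
      × ((k l : Fin (n ^ (n ∸ 1))) → (∀ i j → f k i j ≡ f l i j) → k ≡ l)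
      × ((g : Coloring n) → InGbar g → Σ[ k ∈ Fin (n ^ (n ∸ 1)) ] (∀ i j → f k i j ≡ g i j))))
lemma2p4 zero    ()
lemma2p4 (suc m) _  =
    (λ _ tree → RootedTree.colorMap-inGbar tree)
  , colorMap-injective
  , (λ g g∈ → Inverse.par g g∈ , Inverse.par-rooted g g∈ , Inverse.colorMap-par g g∈)
  , colorMap ∘ codeTree m
  , (λ k → RootedTree.colorMap-inGbar (codeTree-rooted {m} k))
  , (λ k l same → codeTree-injective {m} k l
                    (colorMap-injective _ _ (codeTree-rooted k) (codeTree-rooted l) same))
  , λ g g∈ → let open Inverse g g∈ in
      map₂ (λ k≗par i j → trans (colorMap-cong k≗par i j) (colorMap-par i j))
           (codeTree-surjective par par-rooted)
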